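{- Every online algorithm for the simple unbounded knapsack problem that uses one uniformly random bit (and no other randomness) has competitive ratio in expectation at least $2$.
   Context: Online simple unbounded knapsack problem: knapsack capacity $1$; an instance is a sequence of items $x_1,\dots,x_n$ ($n$ unknown to the algorithm) with sizes $s_i\in[0,1]$ and values $v_i=s_i$. Items arrive one by one; upon arrival of $x_i$ the algorithm irrevocably chooses a number $k_i\in\mathbb{N}_0$ of copies to pack, with the total packed size never exceeding $1$. $\mathrm{opt}(I)=\max\{\sum_i k_i v_i: k_i\in\mathbb{N}_0,\sum_i k_i s_i\le1\}$. For a randomized algorithm, $\mathrm{gain}(I)$ is the expected total packed value, the competitive ratio in expectation on $I$ is $\mathrm{opt}(I)/\mathrm{gain}(I)$, and the competitive ratio in expectation of the algorithm is the supremum of this over all instances.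
   Formalization: The item sizes $s_i$ are taken in the rationals in [0,1] rather than the reals, so the online algorithms act on rational sizes. -}

module Defs where

open import Data.Bool using (Bool; true; false)
open import Data.Nat using (ℕ)
open import Data.Integer using (+_)
open import Data.List using (List; []; _∷_; _++_; [_]; length)
open import Data.List.Relation.Unary.All using (All)
open import Data.Product using (_×_; Σ; ∃)
open import Relation.Binary.PropositionalEquality using (_≡_)
open import Data.Rational using (ℚ; 0ℚ; 1ℚ; ½; _+_; _*_; _≤_; _/_)

-- An instance: the sequence of item sizes s_1,...,s_n (value v_i = s_i).
-- Sizes are rationals.
Instance : Set
Instance = List ℚ

ValidInstance : Instance → Set
ValidInstance I = All (λ s → (0ℚ ≤ s) × (s ≤ 1ℚ)) I

-- An online algorithm using one uniformly random bit: given the bit, the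
-- sizes of the items seen so far (in arrival order) and the size of the
-- current item, it irrevocably decides the number of copies to pack.
Algorithm : Set
Algorithm = Bool → List ℚ → ℚ → ℕ

runFrom : Algorithm → Bool → List ℚ → Instance → List ℕ
runFrom A b hist [] = []
runFrom A b hist (s ∷ I) = A b hist s ∷ runFrom A b (hist ++ [ s ]) I

run : Algorithm → Bool → Instance → List ℕ
run A b I = runFrom A b [] I

ℕtoℚ : ℕ → ℚ
ℕtoℚ k = + k / 1

packed : List ℕ → List ℚ → ℚ
packed (k ∷ ks) (s ∷ I) = ℕtoℚ k * s + packed ks I
packed _ _ = 0ℚ

-- The algorithm never exceeds the capacity 1, for either value of the bit.
-- (Sizes are nonnegative, so this also bounds every intermediate load.)
Feasible : Algorithm → Set
Feasible A = ∀ (b : Bool) (I : Instance) → ValidInstance I → packed (run A b I) I ≤ 1ℚ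

gain : Algorithm → Instance → ℚ
gain A I = ½ * (packed (run A false I) I + packed (run A true I) I)

FeasiblePacking : Instance → List ℕ → Set
FeasiblePacking I ks = (length ks ≡ length I) × (packed ks I ≤ 1ℚ)

IsOpt : Instance → ℚ → Set
IsOpt I o = Σ (List ℕ) (λ ks → FeasiblePacking I ks × (packed ks I ≡ o))
          × (∀ ks → FeasiblePacking I ks → packed ks I ≤ o)

-- The adversary presents one item of size s slightly above ½, so each run of the
-- algorithm packs it at most once.  If some value of the random bit leaves it
-- unpacked, the instance stops: opt = s, while the expected gain is at most s/2.
-- If both values of the bit pack it, an item of size ½ follows, which no longer
-- fits: the gain is s, while two copies of the second item fill the knapsack, so
-- opt = 1.  Taking s close enough to ½ pushes 1/s above any c < 2.
{-# OPTIONS --safe #-}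
module Submission where

open import Defs
open import Data.Product using (_×_; Σ)
open import Data.Rational using (ℚ; _<_; _*_)

open import Data.Bool using (Bool; true; false)
import Data.Integer as ℤ
import Data.Integer.Properties as ℤₚ
open import Data.List using ([]; _∷_; length)
open import Data.List.Relation.Unary.All using ([]; _∷_)
open import Data.Nat as ℕ using (zero; suc; s≤s; z≤n)
open import Data.Nat.Coprimality using (1-coprimeTo) renaming (sym to coprime-sym)
open import Data.Product using (_,_; proj₂; ∃-syntax)
open import Data.Rational using (*≤*; _≤_; _+_; _-_; -_; 0ℚ; 1ℚ; ½; _/_; _≤?_; _<?_; positive; Positive; nonNegative)
open import Data.Rational.Properties
open import Data.Rational.Solver using (module +-*-Solver)
open import Data.Sum using (_⊎_; inj₁; inj₂)
open import Relation.Binary.PropositionalEquality using (_≡_; refl; sym; trans; cong; cong₂; subst; subst₂; module ≡-Reasoning)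
open import Relation.Binary.Definitions using (tri<; tri≈; tri>)
open import Relation.Nullary using (yes; no; contradiction)
open import Relation.Nullary.Decidable using (from-yes)

open +-*-Solver

-- For a variable m, + m / 1 is stuck on gcd m 1; normalize-coprime exposes it as the fraction m/1.
ℕtoℚ-mono-≤ : ∀ {m n} → m ℕ.≤ n → ℕtoℚ m ≤ ℕtoℚ n
ℕtoℚ-mono-≤ {m} {n} m≤n
  rewrite normalize-coprime (coprime-sym (1-coprimeTo m))
        | normalize-coprime (coprime-sym (1-coprimeTo n)) =
  *≤* (subst₂ ℤ._≤_ (sym (ℤₚ.*-identityʳ (ℤ.+ m))) (sym (ℤₚ.*-identityʳ (ℤ.+ n))) (ℤ.+≤+ m≤n))

ℕtoℚ-nonNeg : ∀ k → 0ℚ ≤ ℕtoℚ k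
ℕtoℚ-nonNeg k = ℕtoℚ-mono-≤ {0} {k} z≤n

copies-load-mono : ∀ {t} j k → 0ℚ ≤ t → j ℕ.≤ k → ℕtoℚ j * t ≤ ℕtoℚ k * t + 0ℚ
copies-load-mono {t} j k 0≤t j≤k =
  subst (_ ≤_) (sym (+-identityʳ (ℕtoℚ k * t))) (*-monoʳ-≤-nonNeg t {{nonNegative 0≤t}} (ℕtoℚ-mono-≤ j≤k))

packed-nonNeg : ∀ ks {I} → ValidInstance I → 0ℚ ≤ packed ks I
packed-nonNeg []       _                           = ≤-refl
packed-nonNeg (_ ∷ _)  []                          = ≤-refl
packed-nonNeg (k ∷ ks) {s ∷ _} ((0≤s , _) ∷ valid) =
  +-mono-≤ (subst (_≤ ℕtoℚ k * s) (*-zeroˡ s) (*-monoʳ-≤-nonNeg s {{nonNegative 0≤s}} (ℕtoℚ-nonNeg k)))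
           (packed-nonNeg ks valid)

gain-nonNeg : ∀ A {I} → ValidInstance I → 0ℚ ≤ gain A I
gain-nonNeg A {I} valid =
  *-monoˡ-≤-nonNeg ½ (+-mono-≤ (packed-nonNeg (run A false I) valid) (packed-nonNeg (run A true I) valid))

½<⇒0< : ∀ {s} → ½ < s → 0ℚ < s
½<⇒0< = <-trans (from-yes (0ℚ <? ½))

copies-of-large : ∀ {s} k → ½ < s → ℕtoℚ k * s + 0ℚ ≤ 1ℚ → k ≡ 0 ⊎ k ≡ 1
copies-of-large 0                 _   _    = inj₁ refl
copies-of-large 1                 _   _    = inj₂ refl
copies-of-large {s} (suc (suc k)) ½<s fits =
  contradiction (≤-<-trans overfull (+-mono-< ½<s ½<s)) (<-irrefl refl)
  where
  overfull : s + s ≤ 1ℚ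
  overfull = begin
    s + s                      ≡⟨ solve 1 (λ x → x :+ x := con (ℕtoℚ 2) :* x) refl s ⟩
    ℕtoℚ 2 * s                 ≤⟨ copies-load-mono 2 (suc (suc k)) (<⇒≤ (½<⇒0< ½<s)) (s≤s (s≤s z≤n)) ⟩
    ℕtoℚ (suc (suc k)) * s + 0ℚ ≤⟨ fits ⟩
    1ℚ                         ∎
    where open ≤-Reasoning

copies-of-overflowing : ∀ {t} a m → 0ℚ ≤ t → 1ℚ < a + t → a + (ℕtoℚ m * t + 0ℚ) ≤ 1ℚ → m ≡ 0
copies-of-overflowing     _ zero    _   _        _    = refl
copies-of-overflowing {t} a (suc m) 0≤t overflow fits =
  contradiction (≤-<-trans overfull overflow) (<-irrefl refl)
  where
  overfull : a + t ≤ 1ℚ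
  overfull = begin
    a + t                          ≡⟨ cong (a +_) (sym (*-identityˡ t)) ⟩
    a + ℕtoℚ 1 * t                 ≤⟨ +-monoʳ-≤ a (copies-load-mono 1 (suc m) 0≤t (s≤s z≤n)) ⟩
    a + (ℕtoℚ (suc m) * t + 0ℚ)    ≤⟨ fits ⟩
    1ℚ                             ∎
    where open ≤-Reasoning

filling-packing⇒IsOpt : ∀ {I} ks → length ks ≡ length I → packed ks I ≡ 1ℚ → IsOpt I 1ℚ
filling-packing⇒IsOpt ks same-length fills =
  (ks , (same-length , ≤-reflexive fills) , fills) , λ _ feasible → proj₂ feasible

2*g≤o⇒c*g<o : ∀ {c g o} → c < ℕtoℚ 2 → 0ℚ < o → 0ℚ ≤ g → ℕtoℚ 2 * g ≤ o → c * g < o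
2*g≤o⇒c*g<o {c} {g} {o} c<2 0<o 0≤g 2g≤o with <-cmp 0ℚ g
... | tri< 0<g _ _  = <-≤-trans (*-monoˡ-<-pos g {{positive 0<g}} c<2) 2g≤o
... | tri≈ _ refl _ = subst (_< o) (sym (*-zeroʳ c)) 0<o
... | tri> _ _ g<0  = contradiction (<-≤-trans g<0 0≤g) (<-irrefl refl)

item-size : ∀ {c} → c < ℕtoℚ 2 → ∃[ s ] ½ < s × s ≤ 1ℚ × c * s < 1ℚ
item-size {c} c<2 with 0ℚ ≤? c
... | no c≱0 = 1ℚ , from-yes (½ <? 1ℚ) , ≤-refl ,
               subst (_< 1ℚ) (sym (*-identityʳ c)) (<-trans (≰⇒> c≱0) (from-yes (0ℚ <? 1ℚ)))
... | yes c≥0 = 1ℚ - ¼ * c , ½<s , s≤1 , cs<1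
  where
  ¼ = ℤ.+ 1 / 4
  d = ℕtoℚ 2 - c
  ½<s : ½ < 1ℚ - ¼ * c
  ½<s = +-monoʳ-< 1ℚ (neg-antimono-< (*-monoʳ-<-pos ¼ c<2))
  s≤1 : 1ℚ - ¼ * c ≤ 1ℚ
  s≤1 = +-monoʳ-≤ 1ℚ (neg-antimono-≤ (*-monoˡ-≤-nonNeg ¼ c≥0))
  instance
    d-pos : Positive d
    d-pos = positive (subst (_< d) (+-inverseʳ c) (+-monoˡ-< (- c) c<2))
  -- The choice s = 1 - c/4 makes 1 - c s = ¼ (2 - c)², a positive square.
  defect : c * (1ℚ - ¼ * c) + ¼ * (d * d) ≡ 1ℚ
  defect = solve 1 (λ x → x :* (con 1ℚ :- con ¼ :* x) :+ con ¼ :* ((con (ℕtoℚ 2) :- x) :* (con (ℕtoℚ 2) :- x))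
                          := con 1ℚ) refl c
  cs<1 : c * (1ℚ - ¼ * c) < 1ℚ
  cs<1 = subst₂ _<_ (+-identityʳ _) defect
           (+-monoʳ-< (c * (1ℚ - ¼ * c)) (positive⁻¹ (¼ * (d * d)) {{pos*pos⇒pos ¼ (d * d) {{pos*pos⇒pos d d}}}}))

module Adversary (A : Algorithm) (feasible : Feasible A) {s : ℚ} (½<s : ½ < s) (s≤1 : s ≤ 1ℚ) where

  0<s : 0ℚ < s
  0<s = ½<⇒0< ½<s

  0≤s : 0ℚ ≤ s
  0≤s = <⇒≤ 0<s

  large : Instance
  large = s ∷ []

  large-then-half : Instance
  large-then-half = s ∷ ½ ∷ []

  valid-large : ValidInstance large
  valid-large = (0≤s , s≤1) ∷ []

  valid-large-then-half : ValidInstance large-then-half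
  valid-large-then-half = (0≤s , s≤1) ∷ (from-yes (0ℚ ≤? ½) , from-yes (½ ≤? 1ℚ)) ∷ []

  single-copy-load : ∀ {k} → k ≡ 1 → ℕtoℚ k * s + 0ℚ ≡ s
  single-copy-load refl = trans (+-identityʳ _) (*-identityˡ s)

  no-copy-load : ∀ {k} → k ≡ 0 → ℕtoℚ k * s + 0ℚ ≡ 0ℚ
  no-copy-load refl = trans (+-identityʳ _) (*-zeroˡ s)

  copies-≤-load : ∀ {k} → k ≡ 0 ⊎ k ≡ 1 → ℕtoℚ k * s + 0ℚ ≤ s
  copies-≤-load (inj₁ none) = subst (_≤ s) (sym (no-copy-load none)) 0≤s
  copies-≤-load (inj₂ one)  = ≤-reflexive (single-copy-load one)

  opt-large : IsOpt large s
  opt-large =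
    ((1 ∷ []) , (refl , subst (_≤ 1ℚ) (sym (single-copy-load refl)) s≤1) , single-copy-load refl) , optimal
    where
    optimal : ∀ ks → FeasiblePacking large ks → packed ks large ≤ s
    optimal (k ∷ []) (_ , fits) = copies-≤-load (copies-of-large k ½<s fits)

  opt-large-then-half : IsOpt large-then-half 1ℚ
  opt-large-then-half = filling-packing⇒IsOpt (0 ∷ 2 ∷ []) refl (cong (_+ 1ℚ) (*-zeroˡ s))

  first-copies : ∀ b → A b [] s ≡ 0 ⊎ A b [] s ≡ 1
  first-copies b = copies-of-large (A b [] s) ½<s (feasible b large valid-large)

  half-unpacked-after-large : ∀ {k} m → k ≡ 1 →
    ℕtoℚ k * s + (ℕtoℚ m * ½ + 0ℚ) ≤ 1ℚ → ℕtoℚ k * s + (ℕtoℚ m * ½ + 0ℚ) ≡ s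
  half-unpacked-after-large m refl fits
    with copies-of-overflowing (ℕtoℚ 1 * s) m (from-yes (0ℚ ≤? ½)) overflow fits
    where
    overflow : 1ℚ < ℕtoℚ 1 * s + ½
    overflow = subst (λ x → 1ℚ < x + ½) (sym (*-identityˡ s)) (+-monoˡ-< ½ ½<s)
  ... | refl = single-copy-load refl

  load-large-then-half : ∀ b → A b [] s ≡ 1 → packed (run A b large-then-half) large-then-half ≡ s
  load-large-then-half b one =
    half-unpacked-after-large (A b (s ∷ []) ½) one (feasible b large-then-half valid-large-then-half)

  gain-large-then-half : A false [] s ≡ 1 → A true [] s ≡ 1 → gain A large-then-half ≡ s
  gain-large-then-half f t = begin
    gain A large-then-half ≡⟨ cong₂ (λ x y → ½ * (x + y)) (load-large-then-half false f) (load-large-then-half true t) ⟩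
    ½ * (s + s)            ≡⟨ solve 1 (λ x → con ½ :* (x :+ x) := x) refl s ⟩
    s                      ∎
    where open ≡-Reasoning

  load : Bool → ℚ
  load b = packed (run A b large) large

  double-gain-large : ℕtoℚ 2 * gain A large ≡ load false + load true
  double-gain-large = trans (sym (*-assoc (ℕtoℚ 2) ½ (load false + load true))) (*-identityˡ _)

  dichotomy : ℕtoℚ 2 * gain A large ≤ s ⊎ gain A large-then-half ≡ s
  dichotomy with first-copies false | first-copies true
  ... | inj₂ f | inj₂ t = inj₂ (gain-large-then-half f t)
  ... | inj₁ f | t      = inj₁ (begin
    ℕtoℚ 2 * gain A large   ≡⟨ double-gain-large ⟩
    load false + load true  ≡⟨ cong (_+ load true) (no-copy-load f) ⟩
    0ℚ + load true          ≡⟨ +-identityˡ _ ⟩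
    load true               ≤⟨ copies-≤-load t ⟩
    s                       ∎)
    where open ≤-Reasoning
  ... | inj₂ f | inj₁ t = inj₁ (begin
    ℕtoℚ 2 * gain A large   ≡⟨ double-gain-large ⟩
    load false + load true  ≡⟨ cong (load false +_) (no-copy-load t) ⟩
    load false + 0ℚ         ≡⟨ +-identityʳ _ ⟩
    load false              ≤⟨ copies-≤-load (inj₂ f) ⟩
    s                       ∎)
    where open ≤-Reasoning

  adversary-beats : ∀ {c} → c < ℕtoℚ 2 → c * s < 1ℚ →
          Σ Instance (λ I → ValidInstance I × Σ ℚ (λ o → IsOpt I o × (c * gain A I < o)))
  adversary-beats {c} c<2 cs<1 with dichotomy
  ... | inj₁ 2g≤s = large , valid-large , s , opt-large ,
                    2*g≤o⇒c*g<o c<2 0<s (gain-nonNeg A valid-large) 2g≤s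
  ... | inj₂ g≡s  = large-then-half , valid-large-then-half , 1ℚ , opt-large-then-half ,
                    subst (λ g → c * g < 1ℚ) (sym g≡s) cs<1

theorem2 : (A : Algorithm) → Feasible A → (c : ℚ) → c < Defs.ℕtoℚ 2 →
    Σ Instance (λ I → ValidInstance I × Σ ℚ (λ o → IsOpt I o × (c * gain A I < o)))
theorem2 A feasible c c<2 =
  let s , ½<s , s≤1 , cs<1 = item-size c<2
  in  Adversary.adversary-beats A feasible ½<s s≤1 c<2 cs<1
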